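{- Let $3\le a<b\le2a$ be integers. Then for every $\epsilon>0$, $$\sum_{t=a}^{b-1}\max\{k\ge1:k^2\mid t^2-4\}\ll_\epsilon a^\epsilon a\sqrt{b-a}$$ and $$\sum_{t_1=a}^{b-1}\sum_{t_2=a}^{b-1}S(t_1^2-4,t_2^2-4)\ll_\epsilon a^\epsilon\left(a\sqrt{b-a}+a^{1/2}(b-a)^{3/2}\right).$$
   Context: For integers $n_1,\dots,n_r$ (not all zero), $S(n_1,\dots,n_r)=\max\{k\ge1:k^2\mid\gcd(n_1,\dots,n_r)\}$. The implied constants depend only on $\epsilon$. -}

module Defs where

open import Data.Nat using (ℕ; zero; suc; _+_; _*_; _∸_)
open import Data.Nat.Divisibility using (_∣?_)
open import Data.Nat.GCD using (gcd)
open import Data.List using (List; map; applyUpTo)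
open import Data.Nat.ListAction using (sum)
open import Relation.Nullary using (yes; no)

maxSqUpTo : ℕ → ℕ → ℕ
maxSqUpTo n zero = zero
maxSqUpTo n (suc m) with (suc m * suc m) ∣? n
... | yes _ = suc m
... | no _  = maxSqUpTo n m

-- maxSq n = max{k ≥ 1 : k² ∣ n}, for n ≥ 1 (any such k satisfies k ≤ n)
maxSq : ℕ → ℕ
maxSq n = maxSqUpTo n n

S₂ : ℕ → ℕ → ℕ
S₂ x y = maxSq (gcd x y)

sumRange : ℕ → ℕ → (ℕ → ℕ) → ℕ
sumRange a b f = sum (map f (applyUpTo (λ i → a + i) (b ∸ a)))

-- t² - 4 (used only for t ≥ 3, so truncated subtraction is exact)
tsq4 : ℕ → ℕ
tsq4 t = t * t ∸ 4

-- Write t² − 4 = r k² with k = maxSq (t² − 4) and r its squarefree part. For a ≤ t < b ≤ 2a the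
-- cofactors r are pairwise distinct: two solutions t₁ < t₂ of t² − r k² = 4 compose (Brahmagupta)
-- to a solution of X² − r Y² = 16 with Y > 0, and that forces t₂ ≥ 2 t₁. Distinct r ≥ 1 with
-- r k² ≤ 4a² give Σ k ≤ Σ_{j ≤ b − a} 2a/√j ≤ 4a √(b − a).
--
-- In the double sum, charge S(t₁² − 4, t₂² − 4) to its own value d, so d² divides both t₁² − 4 and
-- t₂² − 4. For fixed d the t with d² ∣ (t − 2)(t + 2) fall into τ(d²) classes according to
-- gcd (d², t − 2), and inside one class they are at least d²/4 apart. Hence the inner sum is at most
-- T² (4(b − a) + k_{t₁}), where T is the largest divisor count up to 4a², and the divisor bound
-- τ(n)^K ≤ C_K n makes T⁴ = O(a^ε). Here a^ε is a^(p/q), both sums being raised to the power 2q.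

module Submission where

open import Defs
open import Data.Nat
  using (ℕ; zero; suc; _+_; _*_; _∸_; _^_; _≤_; _<_; _≤?_; _<?_; _≟_; z≤n; s≤s;
         NonZero; >-nonZero; ≢-nonZero; ≢-nonZero⁻¹; n>1⇒nonTrivial)
open import Data.Nat.Properties
import Algebra.Properties.CommutativeSemigroup as CommutativeSemigroupProperties
open CommutativeSemigroupProperties +-commutativeSemigroup using (interchange; x∙yz≈y∙xz)
open CommutativeSemigroupProperties *-commutativeSemigroup
  using () renaming (interchange to *-interchange; x∙yz≈y∙xz to *-x∙yz≈y∙xz)
open import Data.Nat.Divisibility
open import Data.Nat.DivMod using (_/_; _%_; m≡m%n+[m/n]*n; m%n<n)
open import Data.Nat.GCD using (gcd; gcd[m,n]∣m; gcd[m,n]∣n; gcd[m,n]≢0; c*gcd[m,n]≡gcd[cm,cn])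
open import Data.Nat.LCM using (lcm; lcm-least; gcd*lcm)
open import Data.Nat.Coprimality
  using (Coprime; coprime-divisor; gcd≡1⇒coprime) renaming (sym to coprime-sym)
open import Data.Nat.Primality
  using (Prime; _Rough_; prime⇒nonZero; prime⇒irreducible; ∤⇒rough-suc; rough∧∣⇒prime;
         rough∧∣⇒rough; rough⇒≤; 2-rough)
open import Data.Nat.Induction using (<-wellFounded)
open import Induction.WellFounded using (Acc; acc)
open import Data.Nat.ListAction using (sum)
open import Data.Nat.Tactic.RingSolver using (solve; solve-∀)
import Data.Integer as ℤ
import Data.Integer.Properties as ℤₚ
import Data.Integer.Tactic.RingSolver as ℤ-Solver
open import Data.List
  using (List; []; _∷_; [_]; _++_; map; filter; length; applyUpTo; upTo; cartesianProductWith)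
open import Data.List.Properties
  using (length-map; length-applyUpTo; length-upTo; length-++; length-++-sucʳ; length-filter;
         filter-++; filter-accept; map-cong)
open import Data.List.Extrema.Nat using (argmax; f[xs]≤f[argmax]; argmax-all)
open import Data.List.Membership.Propositional using (_∈_)
open import Data.List.Membership.Propositional.Properties
  using (∈-applyUpTo⁺; ∈-applyUpTo⁻; ∈-filter⁺; ∈-filter⁻; ∈-∃++; ∈-++⁻; ∈-++⁺ˡ; ∈-++⁺ʳ;
         ∈-cartesianProductWith⁺)
open import Data.List.Relation.Binary.Subset.Propositional using (_⊆_)
open import Data.List.Relation.Unary.Any using (here; there)
open import Data.List.Relation.Unary.All as All using (All; []; _∷_)
import Data.List.Relation.Unary.All.Properties as All
open import Data.List.Relation.Unary.AllPairs as AllPairs using (AllPairs; []; _∷_)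
import Data.List.Relation.Unary.AllPairs.Properties as AllPairs
open import Data.List.Relation.Unary.Unique.Propositional using (Unique)
open import Data.Product using (Σ; ∃-syntax; _×_; _,_; proj₁; proj₂)
open import Data.Sum using (inj₁; inj₂)
open import Function using (_∘_; _∋_; id)
open import Relation.Nullary using (Dec; yes; no; ¬_; contradiction)
open import Relation.Unary using (Pred; Decidable)
open import Relation.Unary.Properties using (∁?)
open import Relation.Binary.PropositionalEquality
  using (_≡_; _≢_; refl; sym; trans; cong; cong₂; subst; subst₂; module ≡-Reasoning)

private
  variable
    A B : Set

module _ {f g : A → ℕ} where

  sum-map-mono : ∀ xs → (∀ {x} → x ∈ xs → f x ≤ g x) → sum (map f xs) ≤ sum (map g xs)
  sum-map-mono []       _   = z≤n
  sum-map-mono (x ∷ xs) f≤g = +-mono-≤ (f≤g (here refl)) (sum-map-mono xs (f≤g ∘ there))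

  sum-map-+ : ∀ xs → sum (map (λ x → f x + g x) xs) ≡ sum (map f xs) + sum (map g xs)
  sum-map-+ []       = refl
  sum-map-+ (x ∷ xs) = trans (cong (f x + g x +_) (sum-map-+ xs)) (interchange (f x) (g x) _ _)

sum-map-const : ∀ c (xs : List A) → sum (map (λ _ → c) xs) ≡ length xs * c
sum-map-const c []       = refl
sum-map-const c (x ∷ xs) = cong (c +_) (sum-map-const c xs)

sum-map-*ˡ : ∀ c (f : A → ℕ) xs → sum (map (λ x → c * f x) xs) ≡ c * sum (map f xs)
sum-map-*ˡ c f []       = sym (*-zeroʳ c)
sum-map-*ˡ c f (x ∷ xs) =
  trans (cong (c * f x +_) (sum-map-*ˡ c f xs)) (sym (*-distribˡ-+ c (f x) _))

∈⇒≤-sum-map : ∀ (f : A → ℕ) {x xs} → x ∈ xs → f x ≤ sum (map f xs)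
∈⇒≤-sum-map f {xs = y ∷ _} (here refl) = m≤m+n (f y) _
∈⇒≤-sum-map f {xs = y ∷ _} (there x∈)  = ≤-trans (∈⇒≤-sum-map f x∈) (m≤n+m _ (f y))

module _ {p} {P : Pred A p} (P? : Decidable P) where

  sum-map-filter-∁ : ∀ (f : A → ℕ) xs →
    sum (map f xs) ≡ sum (map f (filter P? xs)) + sum (map f (filter (∁? P?) xs))
  sum-map-filter-∁ f []       = refl
  sum-map-filter-∁ f (x ∷ xs) with P? x
  ... | yes _ = trans (cong (f x +_) (sum-map-filter-∁ f xs)) (sym (+-assoc (f x) _ _))
  ... | no  _ = trans (cong (f x +_) (sum-map-filter-∁ f xs))
                      (x∙yz≈y∙xz (f x) (sum (map f (filter P? xs))) _)

  length-filter-∁ : ∀ (xs : List A) → length xs ≡ length (filter P? xs) + length (filter (∁? P?) xs)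
  length-filter-∁ []       = refl
  length-filter-∁ (x ∷ xs) with P? x
  ... | yes _ = cong suc (length-filter-∁ xs)
  ... | no  _ = trans (cong suc (length-filter-∁ xs)) (sym (+-suc _ _))

module _ {p} {P : B → Pred A p} (P? : ∀ e → Decidable (P e)) (f : A → ℕ) (w : B → ℕ) (E : List B) where

  sum-map-≤-cover : ∀ xs → (∀ {x} → x ∈ xs → ∃[ e ] e ∈ E × P e x × f x ≤ w e) →
    sum (map f xs) ≤ sum (map (λ e → w e * length (filter (P? e) xs)) E)
  sum-map-≤-cover []       _     = z≤n
  sum-map-≤-cover (x ∷ xs) cover with cover (here refl)
  ... | e₀ , e₀∈E , Pe₀x , fx≤we₀ = begin
    f x + sum (map f xs)
      ≤⟨ +-mono-≤ fx≤ (sum-map-≤-cover xs (cover ∘ there)) ⟩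
    sum (map (λ e → w e * count e [ x ]) E) + sum (map (λ e → w e * count e xs) E)
      ≡⟨ sum-map-+ E ⟨
    sum (map (λ e → w e * count e [ x ] + w e * count e xs) E)
      ≡⟨ cong sum (map-cong (λ e → sym (trans (cong (w e *_) (count-∷ e)) (*-distribˡ-+ (w e) _ _))) E) ⟩
    sum (map (λ e → w e * count e (x ∷ xs)) E) ∎
    where
    open ≤-Reasoning
    count : B → List A → ℕ
    count e ys = length (filter (P? e) ys)
    count-∷ : ∀ e → count e (x ∷ xs) ≡ count e [ x ] + count e xs
    count-∷ e = trans (cong length (filter-++ (P? e) [ x ] xs)) (length-++ (filter (P? e) [ x ]))
    fx≤ : f x ≤ sum (map (λ e → w e * count e [ x ]) E)
    fx≤ = begin
      f x                    ≤⟨ fx≤we₀ ⟩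
      w e₀                   ≡⟨ *-identityʳ (w e₀) ⟨
      w e₀ * 1               ≡⟨ cong (λ ys → w e₀ * length ys) (filter-accept (P? e₀) Pe₀x) ⟨
      w e₀ * count e₀ [ x ]  ≤⟨ ∈⇒≤-sum-map (λ e → w e * count e [ x ]) e₀∈E ⟩
      sum (map (λ e → w e * count e [ x ]) E) ∎

length-≤-⊆ : {xs ys : List A} → Unique xs → xs ⊆ ys → length xs ≤ length ys
length-≤-⊆ {xs = []}     _                _     = z≤n
length-≤-⊆ {xs = x ∷ xs} (x∉xs ∷ xs-uniq) xs⊆ys with ∈-∃++ (xs⊆ys (here refl))
... | us , vs , refl = subst (suc (length xs) ≤_) (sym (length-++-sucʳ us x vs))
  (s≤s (length-≤-⊆ xs-uniq xs⊆us++vs))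
  where
  xs⊆us++vs : xs ⊆ us ++ vs
  xs⊆us++vs {y} y∈xs with ∈-++⁻ us (xs⊆ys (there y∈xs))
  ... | inj₁ y∈us         = ∈-++⁺ˡ y∈us
  ... | inj₂ (here refl)  = contradiction refl (All.lookup x∉xs y∈xs)
  ... | inj₂ (there y∈vs) = ∈-++⁺ʳ us y∈vs

length-cartesianProductWith : ∀ {C : Set} (f : A → B → C) xs ys →
  length (cartesianProductWith f xs ys) ≡ length xs * length ys
length-cartesianProductWith f []       ys = refl
length-cartesianProductWith f (x ∷ xs) ys = trans (length-++ (map (f x) ys))
  (cong₂ _+_ (length-map (f x) ys) (length-cartesianProductWith f xs ys))

AllPairs-restrict : ∀ {p r s} {P : A → Set p} {R : A → A → Set r} {S : A → A → Set s} {xs} →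
  (∀ {x y} → P x → P y → R x y → S x y) → All P xs → AllPairs R xs → AllPairs S xs
AllPairs-restrict f []         []         = []
AllPairs-restrict f (px ∷ pxs) (rx ∷ rxs) =
  All.zipWith (λ (py , r) → f px py r) (pxs , rx) ∷ AllPairs-restrict f pxs rxs

module _ {g : ℕ} where

  private
    spaced-last : ∀ {hi x} xs → AllPairs (λ x y → x + g ≤ y) (x ∷ xs) → All (_< hi) (x ∷ xs) →
      length xs * g + x < hi
    spaced-last []       _                          (x<hi ∷ _)    = x<hi
    spaced-last {hi} {x} (y ∷ ys) ((x+g≤y ∷ _) ∷ spaced) (_ ∷ bounded) = begin-strict
      (g + length ys * g) + x ≡⟨ +-assoc g _ x ⟩
      g + (length ys * g + x) ≡⟨ trans (+-comm g _) (+-assoc (length ys * g) x g) ⟩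
      length ys * g + (x + g) ≤⟨ +-monoʳ-≤ (length ys * g) x+g≤y ⟩
      length ys * g + y       <⟨ spaced-last ys spaced bounded ⟩
      hi                      ∎
      where open ≤-Reasoning

  length-spaced : ∀ {lo w} xs → AllPairs (λ x y → x + g ≤ y) xs →
    All (λ x → lo ≤ x × x < lo + w) xs → length xs * g ≤ w + g
  length-spaced          []       _      _                          = z≤n
  length-spaced {lo} {w} (x ∷ xs) spaced bounded@((lo≤x , _) ∷ _) = begin
    g + length xs * g ≡⟨ +-comm g _ ⟩
    length xs * g + g ≤⟨ +-monoˡ-≤ g (<⇒≤ (+-cancelˡ-< lo _ _ lo+len<lo+w)) ⟩
    w + g             ∎
    where
    open ≤-Reasoning
    lo+len<lo+w : lo + length xs * g < lo + w
    lo+len<lo+w = begin-strict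
      lo + length xs * g ≡⟨ +-comm lo _ ⟩
      length xs * g + lo ≤⟨ +-monoʳ-≤ _ lo≤x ⟩
      length xs * g + x  <⟨ spaced-last xs spaced (All.map proj₂ bounded) ⟩
      lo + w             ∎

range : ℕ → ℕ → List ℕ
range a n = applyUpTo (a +_) n

∈-range⁻ : ∀ {a n t} → t ∈ range a n → a ≤ t × t < a + n
∈-range⁻ {a = a} t∈ with ∈-applyUpTo⁻ (a +_) t∈
... | i , i<n , refl = m≤m+n a i , +-monoʳ-< a i<n

∈-range⁺ : ∀ {a t n} → a ≤ t → t < a + n → t ∈ range a n
∈-range⁺ {a} {t} a≤t t<a+n = subst (_∈ range a _) (m+[n∸m]≡n a≤t)
  (∈-applyUpTo⁺ (a +_) (+-cancelˡ-< a _ _ (subst (_< a + _) (sym (m+[n∸m]≡n a≤t)) t<a+n)))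

All-range : ∀ {a n p} {P : ℕ → Set p} → (∀ {t} → a ≤ t → t < a + n → P t) → All P (range a n)
All-range P-range = All.tabulate (λ t∈ → let a≤t , t< = ∈-range⁻ t∈ in P-range a≤t t<)

AllPairs-range : ∀ {a n r} {R : ℕ → ℕ → Set r} →
  (∀ {s t} → a ≤ s → s < t → t < a + n → R s t) → AllPairs R (range a n)
AllPairs-range {a} {n} R-range = AllPairs.applyUpTo⁺₁ (a +_) n
  (λ i<j j<n → R-range (m≤m+n a _) (+-monoʳ-< a i<j) (+-monoʳ-< a j<n))

^-distribʳ-* : ∀ m n k → (m * n) ^ k ≡ m ^ k * n ^ k
^-distribʳ-* m n zero    = refl
^-distribʳ-* m n (suc k) =
  trans (cong (m * n *_) (^-distribʳ-* m n k)) (*-interchange m n (m ^ k) (n ^ k))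

1+n≤2^n : ∀ n → suc n ≤ 2 ^ n
1+n≤2^n zero    = s≤s z≤n
1+n≤2^n (suc n) = +-mono-≤ (≤-trans (s≤s z≤n) (1+n≤2^n n)) (≤-trans (1+n≤2^n n) (m≤m+n (2 ^ n) 0))

x²≤y⇒x^[2q]≤y^q : ∀ {x y} q → x * x ≤ y → x ^ (2 * q) ≤ y ^ q
x²≤y⇒x^[2q]≤y^q {x} {y} q x²≤y = begin
  x ^ (2 * q)        ≡⟨ ^-*-assoc x 2 q ⟨
  (x * (x * 1)) ^ q  ≡⟨ cong (λ z → (x * z) ^ q) (*-identityʳ x) ⟩
  (x * x) ^ q        ≤⟨ ^-monoˡ-≤ q x²≤y ⟩
  y ^ q              ∎
  where open ≤-Reasoning

square-cancel-< : ∀ {x y} → x * x < y * y → x < y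
square-cancel-< xx<yy = ≰⇒> (λ y≤x → <⇒≱ xx<yy (*-mono-≤ y≤x y≤x))

square-cancel-≤ : ∀ {x y} → x * x ≤ y * y → x ≤ y
square-cancel-≤ xx≤yy = ≮⇒≥ (λ y<x → <⇒≱ (*-mono-< y<x y<x) xx≤yy)

-- (x + y)² + (x − y)² = 2 (x² + y²). The annotation List ℕ ∋ … tells the solver which of the
-- overloaded list constructors (List, All, AllPairs) its variable list uses.
[x+y]²≤2[x²+y²] : ∀ x y → (x + y) * (x + y) ≤ 2 * (x * x + y * y)
[x+y]²≤2[x²+y²] x y with ≤-total x y
... | inj₁ x≤y with d , refl ← m≤n⇒∃[o]m+o≡n x≤y = begin
  (x + (x + d)) * (x + (x + d))          ≤⟨ m≤m+n _ (d * d) ⟩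
  (x + (x + d)) * (x + (x + d)) + d * d  ≡⟨ solve (List ℕ ∋ (x ∷ d ∷ [])) ⟩
  2 * (x * x + (x + d) * (x + d))        ∎
  where open ≤-Reasoning
... | inj₂ y≤x with d , refl ← m≤n⇒∃[o]m+o≡n y≤x = begin
  (y + d + y) * (y + d + y)              ≤⟨ m≤m+n _ (d * d) ⟩
  (y + d + y) * (y + d + y) + d * d      ≡⟨ solve (List ℕ ∋ (y ∷ d ∷ [])) ⟩
  2 * ((y + d) * (y + d) + y * y)        ∎
  where open ≤-Reasoning

∣⇒pos : ∀ {n d} → 0 < n → d ∣ n → 0 < d
∣⇒pos {d = zero}  0<n 0∣n = contradiction (0∣⇒≡0 0∣n) (>⇒≢ 0<n)
∣⇒pos {d = suc _} _   _   = s≤s z≤n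

∣-∸ : ∀ {d x y} → x ≤ y → d ∣ y → d ∣ x → d ∣ y ∸ x
∣-∸ x≤y d∣y d∣x = ∣m+n∣m⇒∣n (subst (_ ∣_) (sym (m+[n∸m]≡n x≤y)) d∣y) d∣x

maxSqUpTo-maximal : ∀ {n j} m → 0 < j → j ≤ m → j * j ∣ n → j ≤ maxSqUpTo n m
maxSqUpTo-maximal zero 0<j j≤0 _ = contradiction (≤-trans 0<j j≤0) λ ()
maxSqUpTo-maximal {n} (suc m) 0<j j≤1+m jj∣n with suc m * suc m ∣? n
... | yes _ = j≤1+m
... | no  ∤ with m≤n⇒m<n∨m≡n j≤1+m
...   | inj₁ j<1+m = maxSqUpTo-maximal m 0<j (≤-pred j<1+m) jj∣n
...   | inj₂ refl  = contradiction jj∣n ∤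

maxSqUpTo-sq∣ : ∀ n m → maxSqUpTo n (suc m) * maxSqUpTo n (suc m) ∣ n
maxSqUpTo-sq∣ n m with suc m * suc m ∣? n
maxSqUpTo-sq∣ n m       | yes mm∣n = mm∣n
maxSqUpTo-sq∣ n zero    | no  ∤    = contradiction (1∣ n) ∤
maxSqUpTo-sq∣ n (suc m) | no  _    = maxSqUpTo-sq∣ n m

maxSq-sq∣ : ∀ n → maxSq n * maxSq n ∣ n
maxSq-sq∣ zero    = ∣-refl
maxSq-sq∣ (suc n) = maxSqUpTo-sq∣ (suc n) n

maxSq-maximal : ∀ {n j} → 0 < n → 0 < j → j * j ∣ n → j ≤ maxSq n
maxSq-maximal {n} {j} 0<n 0<j jj∣n = maxSqUpTo-maximal n 0<j
  (≤-trans (m≤m*n j j {{>-nonZero 0<j}}) (∣⇒≤ {{>-nonZero 0<n}} jj∣n)) jj∣n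

maxSq-pos : ∀ {n} → 0 < n → 0 < maxSq n
maxSq-pos 0<n = maxSq-maximal 0<n ≤-refl (1∣ _)

-- Squarefree by the maximality of maxSq, although only the factorisation below is used.
squarefreePart : ℕ → ℕ
squarefreePart n = quotient (maxSq-sq∣ n)

squarefreePart-maxSq : ∀ n → n ≡ squarefreePart n * (maxSq n * maxSq n)
squarefreePart-maxSq n = _∣_.equality (maxSq-sq∣ n)

squarefreePart-pos : ∀ {n} → 0 < n → 0 < squarefreePart n
squarefreePart-pos {n} 0<n with squarefreePart n | squarefreePart-maxSq n
... | zero  | n≡0 = contradiction n≡0 (>⇒≢ 0<n)
... | suc _ | _   = s≤s z≤n

-- Divisors and the divisor bound

divisors : ℕ → List ℕ
divisors n = filter (_∣? n) (range 1 n)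

τ : ℕ → ℕ
τ n = length (divisors n)

∈-divisors⁺ : ∀ {n d} → 0 < n → d ∣ n → d ∈ divisors n
∈-divisors⁺ {n} 0<n d∣n = ∈-filter⁺ (_∣? n) {xs = range 1 n}
  (∈-range⁺ (∣⇒pos 0<n d∣n) (s≤s (∣⇒≤ {{>-nonZero 0<n}} d∣n))) d∣n

∈-divisors⁻ : ∀ {d n} → d ∈ divisors n → d ∣ n
∈-divisors⁻ {n = n} = proj₂ ∘ ∈-filter⁻ (_∣? n) {xs = range 1 n}

divisors-unique : ∀ n → Unique (divisors n)
divisors-unique n = AllPairs.filter⁺ (_∣? n) (AllPairs-range {1} {n} (λ _ s<t _ → <⇒≢ s<t))

∤⇒coprime : ∀ {p n} → Prime p → ¬ p ∣ n → Coprime p n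
∤⇒coprime prime-p p∤n (i∣p , i∣n) with prime⇒irreducible prime-p i∣p
... | inj₁ i≡1  = i≡1
... | inj₂ refl = contradiction i∣n p∤n

∣p^e*m⇒ : ∀ {p d m} → Prime p → ∀ e → d ∣ p ^ e * m →
  ∃[ i ] ∃[ d′ ] i ≤ e × d′ ∣ m × d ≡ p ^ i * d′
∣p^e*m⇒ {d = d} _ zero d∣m = 0 , d , z≤n , subst (d ∣_) (*-identityˡ _) d∣m , sym (*-identityˡ d)
∣p^e*m⇒ {p} {d} {m} prime-p (suc e) d∣p^[1+e]m with p ∣? d
... | yes (divides d/p refl) =
  let i , d′ , i≤e , d′∣m , d/p≡ = ∣p^e*m⇒ prime-p e d/p∣p^em
  in suc i , d′ , s≤s i≤e , d′∣m , trans (cong (_* p) d/p≡) (p^i*d′*p≡ i d′)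
  where
  instance _ = prime⇒nonZero prime-p
  d/p∣p^em : d/p ∣ p ^ e * m
  d/p∣p^em = *-cancelˡ-∣ p (subst₂ _∣_ (*-comm d/p p) (*-assoc p (p ^ e) m) d∣p^[1+e]m)
  p^i*d′*p≡ : ∀ i d′ → p ^ i * d′ * p ≡ p ^ suc i * d′
  p^i*d′*p≡ i d′ = trans (*-comm _ p) (sym (*-assoc p (p ^ i) d′))
... | no p∤d =
  let i , d′ , i≤e , rest = ∣p^e*m⇒ prime-p e (coprime-divisor (coprime-sym (∤⇒coprime prime-p p∤d))
                              (subst (d ∣_) (*-assoc p (p ^ e) m) d∣p^[1+e]m))
  in i , d′ , m≤n⇒m≤1+n i≤e , rest

τ[p^e*m]≤ : ∀ {p m} → Prime p → 0 < m → ∀ e → τ (p ^ e * m) ≤ suc e * τ m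
τ[p^e*m]≤ {p} {m} prime-p 0<m e = begin
  τ (p ^ e * m)                ≤⟨ length-≤-⊆ (divisors-unique (p ^ e * m)) divisors⊆ ⟩
  length candidates            ≡⟨ length-cartesianProductWith _ (upTo (suc e)) (divisors m) ⟩
  length (upTo (suc e)) * τ m  ≡⟨ cong (_* τ m) (length-upTo (suc e)) ⟩
  suc e * τ m                  ∎
  where
  open ≤-Reasoning
  candidates = cartesianProductWith (λ i d′ → p ^ i * d′) (upTo (suc e)) (divisors m)
  divisors⊆ : divisors (p ^ e * m) ⊆ candidates
  divisors⊆ d∈ with ∣p^e*m⇒ prime-p e (∈-divisors⁻ d∈)
  ... | i , d′ , i≤e , d′∣m , refl = ∈-cartesianProductWith⁺ (λ i d′ → p ^ i * d′)
    (∈-applyUpTo⁺ id (s≤s i≤e)) (∈-divisors⁺ 0<m d′∣m)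

split-power : ∀ {p} → 1 < p → ∀ n → 0 < n → ∃[ e ] ∃[ m ] n ≡ p ^ e * m × ¬ p ∣ m
split-power {p} 1<p n = go n (<-wellFounded n)
  where
  go : ∀ n → Acc _<_ n → 0 < n → ∃[ e ] ∃[ m ] n ≡ p ^ e * m × ¬ p ∣ m
  go n (acc rec) 0<n with p ∣? n
  ... | no  p∤n = 0 , n , sym (*-identityˡ n) , p∤n
  ... | yes (divides q refl) =
    let e , m , q≡p^em , p∤m = go q (rec q<qp) 0<q
    in suc e , m , trans (*-comm q p) (trans (cong (p *_) q≡p^em) (sym (*-assoc p (p ^ e) m))) , p∤m
    where
    0<q : 0 < q
    0<q = ∣⇒pos 0<n (divides p (*-comm q p))
    q<qp : q < q * p
    q<qp = m<m*n q p {{>-nonZero 0<q}} 1<p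

maxτ : ℕ → ℕ
maxτ N = τ (argmax τ 1 (range 1 N))

τ≤maxτ : ∀ {n N} → 0 < n → n ≤ N → τ n ≤ maxτ N
τ≤maxτ {N = N} 0<n n≤N = All.lookup (f[xs]≤f[argmax] 1 (range 1 N)) (∈-range⁺ 0<n (s≤s n≤N))

divisorBoundConstant : ℕ → ℕ
divisorBoundConstant K = (K ^ K) ^ (2 ^ K)

module DivisorBound (K : ℕ) .{{_ : NonZero K}} where

  c : ℕ
  c = K ^ K

  instance
    c≢0 : NonZero c
    c≢0 = m^n≢0 K K

  [1+e]^K≤[2^K]^e : ∀ e → suc e ^ K ≤ (2 ^ K) ^ e
  [1+e]^K≤[2^K]^e e = begin
    suc e ^ K    ≤⟨ ^-monoˡ-≤ K (1+n≤2^n e) ⟩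
    (2 ^ e) ^ K  ≡⟨ ^-*-assoc 2 e K ⟩
    2 ^ (e * K)  ≡⟨ cong (2 ^_) (*-comm e K) ⟩
    2 ^ (K * e)  ≡⟨ ^-*-assoc 2 K e ⟨
    (2 ^ K) ^ e  ∎
    where open ≤-Reasoning

  -- Writing e = r + s K with r < K gives 1 + e ≤ K (1 + s) ≤ K 2^s.
  [1+e]^K≤c*2^e : ∀ e → suc e ^ K ≤ c * 2 ^ e
  [1+e]^K≤c*2^e e = begin
    suc e ^ K        ≤⟨ ^-monoˡ-≤ K 1+e≤K*2^s ⟩
    (K * 2 ^ s) ^ K  ≡⟨ ^-distribʳ-* K (2 ^ s) K ⟩
    c * (2 ^ s) ^ K  ≡⟨ cong (c *_) (^-*-assoc 2 s K) ⟩
    c * 2 ^ (s * K)  ≤⟨ *-monoʳ-≤ c (^-monoʳ-≤ 2 (subst (s * K ≤_) (sym e≡r+sK) (m≤n+m (s * K) r))) ⟩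
    c * 2 ^ e        ∎
    where
    open ≤-Reasoning
    s = e / K
    r = e % K
    e≡r+sK : e ≡ r + s * K
    e≡r+sK = m≡m%n+[m/n]*n e K
    1+e≤K*2^s : suc e ≤ K * 2 ^ s
    1+e≤K*2^s = begin
      suc e          ≡⟨ cong suc e≡r+sK ⟩
      suc r + s * K  ≤⟨ +-monoˡ-≤ (s * K) (m%n<n e K) ⟩
      suc s * K      ≡⟨ *-comm (suc s) K ⟩
      K * suc s      ≤⟨ *-monoʳ-≤ K (1+n≤2^n s) ⟩
      K * 2 ^ s      ∎

  -- Only primes below 2^K cost a factor c; the exponent 2^K ∸ p counts the candidates left.
  prime-power-weight : ∀ {p} → 2 ≤ p → ∀ e → suc e ^ K * c ^ (2 ^ K ∸ suc p) ≤ p ^ e * c ^ (2 ^ K ∸ p)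
  prime-power-weight {p} 2≤p e with p <? 2 ^ K
  ... | yes p<2^K = begin
    suc e ^ K * c ^ x        ≤⟨ *-monoˡ-≤ (c ^ x) ([1+e]^K≤c*2^e e) ⟩
    c * 2 ^ e * c ^ x        ≤⟨ *-monoˡ-≤ (c ^ x) (*-monoʳ-≤ c (^-monoˡ-≤ e 2≤p)) ⟩
    c * p ^ e * c ^ x        ≡⟨ cong (_* c ^ x) (*-comm c (p ^ e)) ⟩
    p ^ e * c * c ^ x        ≡⟨ *-assoc (p ^ e) c (c ^ x) ⟩
    p ^ e * c ^ suc x        ≡⟨ cong (λ y → p ^ e * c ^ y) (+-∸-assoc 1 p<2^K) ⟨
    p ^ e * c ^ (2 ^ K ∸ p)  ∎
    where
    open ≤-Reasoning
    x = 2 ^ K ∸ suc p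
  ... | no  p≮2^K
    rewrite m≤n⇒m∸n≡0 (≤-trans (≮⇒≥ p≮2^K) (n≤1+n p)) | m≤n⇒m∸n≡0 (≮⇒≥ p≮2^K) =
    *-monoˡ-≤ 1 (≤-trans ([1+e]^K≤[2^K]^e e) (^-monoˡ-≤ e (≮⇒≥ p≮2^K)))

  -- Sweep j upwards, splitting off the full power of j whenever j divides n;
  -- j-roughness makes every such j prime, and n < s + j bounds the sweep.
  τ^K-rough : ∀ s {j n} → 2 ≤ j → j Rough n → 0 < n → n < s + j → τ n ^ K ≤ c ^ (2 ^ K ∸ j) * n
  τ^K-rough zero {j} {n = 1} _ _ _ _ =
    subst (_≤ c ^ (2 ^ K ∸ j) * 1) (sym (^-zeroˡ K)) (*-monoˡ-≤ 1 (m^n>0 c (2 ^ K ∸ j)))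
  τ^K-rough zero {n = suc (suc _)} _ rough _ n<j = contradiction (rough⇒≤ rough) (<⇒≱ n<j)
  τ^K-rough (suc s) {j} {n} 2≤j rough 0<n n<1+s+j with j ∣? n
  ... | no  j∤n = begin
    τ n ^ K                   ≤⟨ τ^K-rough s (m≤n⇒m≤1+n 2≤j) (∤⇒rough-suc j∤n rough) 0<n n<s+1+j ⟩
    c ^ (2 ^ K ∸ suc j) * n   ≤⟨ *-monoˡ-≤ n (^-monoʳ-≤ c (∸-monoʳ-≤ (2 ^ K) (n≤1+n j))) ⟩
    c ^ (2 ^ K ∸ j) * n       ∎
    where
    open ≤-Reasoning
    n<s+1+j = subst (n <_) (sym (+-suc s j)) n<1+s+j
  ... | yes j∣n with split-power 2≤j n 0<n
  ...   | e , m , refl , j∤m = begin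
    τ (j ^ e * m) ^ K                  ≤⟨ ^-monoˡ-≤ K (τ[p^e*m]≤ prime-j 0<m e) ⟩
    (suc e * τ m) ^ K                  ≡⟨ ^-distribʳ-* (suc e) (τ m) K ⟩
    suc e ^ K * τ m ^ K
      ≤⟨ *-monoʳ-≤ (suc e ^ K) (τ^K-rough s (m≤n⇒m≤1+n 2≤j) rough-m 0<m m<s+1+j) ⟩
    suc e ^ K * (c ^ (2 ^ K ∸ suc j) * m)  ≡⟨ *-assoc (suc e ^ K) _ m ⟨
    suc e ^ K * c ^ (2 ^ K ∸ suc j) * m    ≤⟨ *-monoˡ-≤ m (prime-power-weight 2≤j e) ⟩
    j ^ e * c ^ (2 ^ K ∸ j) * m        ≡⟨ *-assoc (j ^ e) _ m ⟩
    j ^ e * (c ^ (2 ^ K ∸ j) * m)      ≡⟨ *-x∙yz≈y∙xz (j ^ e) (c ^ (2 ^ K ∸ j)) m ⟩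
    c ^ (2 ^ K ∸ j) * (j ^ e * m)      ∎
    where
    open ≤-Reasoning
    prime-j : Prime j
    prime-j = rough∧∣⇒prime {{n>1⇒nonTrivial 2≤j}} rough j∣n
    m∣n : m ∣ j ^ e * m
    m∣n = n∣m*n (j ^ e)
    0<m : 0 < m
    0<m = ∣⇒pos 0<n m∣n
    rough-m : suc j Rough m
    rough-m = ∤⇒rough-suc j∤m (rough∧∣⇒rough rough m∣n)
    m<s+1+j : m < s + suc j
    m<s+1+j = subst (m <_) (sym (+-suc s j)) (≤-<-trans (∣⇒≤ {{>-nonZero 0<n}} m∣n) n<1+s+j)

  τ^K≤ : ∀ {n} → 0 < n → τ n ^ K ≤ divisorBoundConstant K * n
  τ^K≤ {n} 0<n = begin
    τ n ^ K                ≤⟨ τ^K-rough (suc n) ≤-refl 2-rough 0<n (m≤m+n (suc n) 2) ⟩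
    c ^ (2 ^ K ∸ 2) * n    ≤⟨ *-monoˡ-≤ n (^-monoʳ-≤ c (m∸n≤m (2 ^ K) 2)) ⟩
    c ^ (2 ^ K) * n        ∎
    where open ≤-Reasoning

  maxτ^K≤ : ∀ {N} → 0 < N → maxτ N ^ K ≤ divisorBoundConstant K * N
  maxτ^K≤ {N} 0<N = ≤-trans (τ^K≤ 0<m) (*-monoʳ-≤ (divisorBoundConstant K) m≤N)
    where
    record-holder-bounds : 0 < argmax τ 1 (range 1 N) × argmax τ 1 (range 1 N) ≤ N
    record-holder-bounds = argmax-all τ (≤-refl , 0<N) (All-range (λ 1≤t t<1+N → 1≤t , ≤-pred t<1+N))
    0<m = proj₁ record-holder-bounds
    m≤N = proj₂ record-holder-bounds

-- Square divisors of t² − 4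

-- With e = gcd M x and x = x′ e, the cofactor f = M / e is coprime to x′: e · gcd f x′ = gcd M x = e.
cofactor-∣ : ∀ {M f x z} .{{_ : NonZero M}} → M ≡ f * gcd M x → M ∣ x * z → f ∣ z
cofactor-∣ {M} {f} {x} {z} M≡fe M∣xz =
  coprime-divisor f⊥x′ (*-cancelʳ-∣ e (subst₂ _∣_ M≡fe xz≡x′ze M∣xz))
  where
  e = gcd M x
  instance
    e≢0 : NonZero e
    e≢0 = ≢-nonZero (gcd[m,n]≢0 M x (inj₁ (≢-nonZero⁻¹ M)))
  x′ = quotient (gcd[m,n]∣n M x)
  x≡x′e : x ≡ x′ * e
  x≡x′e = _∣_.equality (gcd[m,n]∣n M x)
  xz≡x′ze : x * z ≡ x′ * z * e
  xz≡x′ze = trans (cong (_* z) x≡x′e)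
    (trans (*-assoc x′ e z) (trans (cong (x′ *_) (*-comm e z)) (sym (*-assoc x′ z e))))
  e*gcd[f,x′]≡e*1 : e * gcd f x′ ≡ e * 1
  e*gcd[f,x′]≡e*1 = begin
    e * gcd f x′           ≡⟨ c*gcd[m,n]≡gcd[cm,cn] e f x′ ⟩
    gcd (e * f) (e * x′)   ≡⟨ cong₂ gcd (trans (*-comm e f) (sym M≡fe))
                                        (trans (*-comm e x′) (sym x≡x′e)) ⟩
    gcd M x                ≡⟨ *-identityʳ e ⟨
    e * 1                  ∎
    where open ≡-Reasoning
  f⊥x′ = gcd≡1⇒coprime (*-cancelˡ-≡ (gcd f x′) 1 e e*gcd[f,x′]≡e*1)

-- With e = gcd M x = gcd M y and M = f e: e ∣ y − x, f ∣ (y + c) − (x + c) and gcd e f ∣ (x + c) − x = c,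
-- hence M = gcd e f · lcm e f ∣ c (y − x).
∣-gap : ∀ {M x c y} .{{_ : NonZero M}} → M ∣ x * (x + c) → M ∣ y * (y + c) →
  gcd M x ≡ gcd M y → x ≤ y → M ∣ c * (y ∸ x)
∣-gap {M} {x} {c} {y} M∣x[x+c] M∣y[y+c] gcd≡ x≤y =
  subst (_∣ c * (y ∸ x)) gcd*lcm≡M (*-pres-∣ gcd[e,f]∣c (lcm-least e∣y∸x f∣y∸x))
  where
  e = gcd M x
  f = quotient (gcd[m,n]∣m M x)
  M≡fe : M ≡ f * e
  M≡fe = _∣_.equality (gcd[m,n]∣m M x)
  e∣x : e ∣ x
  e∣x = gcd[m,n]∣n M x
  e∣y∸x : e ∣ y ∸ x
  e∣y∸x = ∣-∸ x≤y (subst (_∣ y) (sym gcd≡) (gcd[m,n]∣n M y)) e∣x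
  f∣x+c : f ∣ x + c
  f∣x+c = cofactor-∣ M≡fe M∣x[x+c]
  f∣y∸x : f ∣ y ∸ x
  f∣y∸x = subst (f ∣_) (trans (cong₂ _∸_ (+-comm y c) (+-comm x c)) ([m+n]∸[m+o]≡n∸o c y x))
    (∣-∸ (+-monoˡ-≤ c x≤y) (cofactor-∣ (subst (λ g → M ≡ f * g) gcd≡ M≡fe) M∣y[y+c]) f∣x+c)
  gcd[e,f]∣c : gcd e f ∣ c
  gcd[e,f]∣c = subst (gcd e f ∣_) (m+n∸m≡n x c)
    (∣-∸ (m≤m+n x c) (∣-trans (gcd[m,n]∣n e f) f∣x+c) (∣-trans (gcd[m,n]∣m e f) e∣x))
  gcd*lcm≡M : gcd e f * lcm e f ≡ M
  gcd*lcm≡M = trans (gcd*lcm e f) (trans (*-comm e f) (sym M≡fe))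

tsq4≡ : ∀ {t} → 2 ≤ t → tsq4 t ≡ (t ∸ 2) * (t ∸ 2 + 4)
tsq4≡ {suc zero} (s≤s ())
tsq4≡ {suc (suc s)} _ = trans (cong (_∸ 4) ([2+s]²≡ s)) (m+n∸n≡m _ 4)
  where
  [2+s]²≡ : ∀ s → (2 + s) * (2 + s) ≡ s * (s + 4) + 4
  [2+s]²≡ = solve-∀

tsq4-gap : ∀ {d t t′} → 2 ≤ t → t < t′ → 0 < d → d * d ∣ tsq4 t → d * d ∣ tsq4 t′ →
  gcd (d * d) (t ∸ 2) ≡ gcd (d * d) (t′ ∸ 2) → 4 * t + d * d ≤ 4 * t′
tsq4-gap {t = suc zero} (s≤s ())
tsq4-gap {d} {t@(suc (suc s))} {t′} 2≤t t<t′ 0<d dd∣ dd∣′ gcd≡ = begin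
  4 * t + d * d          ≤⟨ +-monoʳ-≤ (4 * t) (∣⇒≤ {{>-nonZero 0<4[t′∸t]}} dd∣4[t′∸t]) ⟩
  4 * t + 4 * (t′ ∸ t)   ≡⟨ *-distribˡ-+ 4 t (t′ ∸ t) ⟨
  4 * (t + (t′ ∸ t))     ≡⟨ cong (4 *_) (m+[n∸m]≡n (<⇒≤ t<t′)) ⟩
  4 * t′                 ∎
  where
  open ≤-Reasoning
  instance
    dd≢0 : NonZero (d * d)
    dd≢0 = >-nonZero (*-mono-< 0<d 0<d)
  dd∣4[t′∸t] : d * d ∣ 4 * (t′ ∸ t)
  dd∣4[t′∸t] = subst (λ n → d * d ∣ 4 * n) (∸-+-assoc t′ 2 s)
    (∣-gap (subst (d * d ∣_) (tsq4≡ 2≤t) dd∣)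
           (subst (d * d ∣_) (tsq4≡ (≤-trans 2≤t (<⇒≤ t<t′))) dd∣′)
      gcd≡ (∸-monoˡ-≤ 2 (<⇒≤ t<t′)))
  0<4[t′∸t] : 0 < 4 * (t′ ∸ t)
  0<4[t′∸t] = *-monoʳ-< 4 (m<n⇒0<n∸m t<t′)

-- Sort the t by their class e = gcd (d²) (t − 2), a divisor of d²: by tsq4-gap, the t in one class
-- are d²/4 apart.
count-sq∣tsq4 : ∀ {d a} L → 2 ≤ a → 0 < d →
  length (filter (λ t → d * d ∣? tsq4 t) (range a L)) * (d * d) ≤ τ (d * d) * (4 * L + d * d)
count-sq∣tsq4 {d} {a} L 2≤a 0<d = begin
  length ts * M                                  ≡⟨ sum-map-const M ts ⟨
  sum (map (λ _ → M) ts)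
                                    ≤⟨ sum-map-≤-cover Class? (λ _ → M) (λ _ → M) (divisors M) ts covered ⟩
  sum (map (λ e → M * length (filter (Class? e) ts)) (divisors M))
                                                 ≤⟨ sum-map-mono (divisors M) (λ {e} _ → class-bound e) ⟩
  sum (map (λ _ → 4 * L + M) (divisors M))       ≡⟨ sum-map-const (4 * L + M) (divisors M) ⟩
  τ M * (4 * L + M)                              ∎
  where
  open ≤-Reasoning
  M = d * d
  0<M : 0 < M
  0<M = *-mono-< 0<d 0<d
  ts = filter (λ t → M ∣? tsq4 t) (range a L)
  Class : ℕ → ℕ → Set
  Class e t = gcd M (t ∸ 2) ≡ e
  Class? : ∀ e t → Dec (Class e t)
  Class? e t = gcd M (t ∸ 2) ≟ e
  covered : ∀ {t} → t ∈ ts → ∃[ e ] e ∈ divisors M × Class e t × M ≤ M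
  covered {t} _ = gcd M (t ∸ 2) , ∈-divisors⁺ 0<M (gcd[m,n]∣m M (t ∸ 2)) , refl , ≤-refl
  class-bound : ∀ e → M * length (filter (Class? e) ts) ≤ 4 * L + M
  class-bound e = begin
    M * length cls            ≡⟨ *-comm M _ ⟩
    length cls * M            ≡⟨ cong (_* M) (length-map (4 *_) cls) ⟨
    length (map (4 *_) cls) * M
      ≤⟨ length-spaced (map (4 *_) cls) (AllPairs.map⁺ spaced) (All.map⁺ (All.map bounds in-range)) ⟩
    4 * L + M                 ∎
    where
    cls = filter (Class? e) ts
    InClass : ℕ → Set
    InClass t = (a ≤ t × t < a + L) × M ∣ tsq4 t × Class e t
    in-range : All InClass cls
    in-range = All.tabulate λ t∈ →
      let t∈ts , cl = ∈-filter⁻ (Class? e) {xs = ts} t∈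
          t∈range , M∣ = ∈-filter⁻ (λ t → M ∣? tsq4 t) {xs = range a L} t∈ts
      in ∈-range⁻ t∈range , M∣ , cl
    sorted : AllPairs _<_ cls
    sorted = AllPairs.filter⁺ (Class? e) (AllPairs.filter⁺ (λ t → M ∣? tsq4 t)
      (AllPairs-range {a} {L} (λ _ s<t _ → s<t)))
    spaced : AllPairs (λ s t → 4 * s + M ≤ 4 * t) cls
    spaced = AllPairs-restrict
      (λ ((a≤s , _) , M∣s , cl-s) (_ , M∣t , cl-t) s<t →
        tsq4-gap (≤-trans 2≤a a≤s) s<t 0<d M∣s M∣t (trans cl-s (sym cl-t)))
      in-range sorted
    bounds : ∀ {t} → InClass t → 4 * a ≤ 4 * t × 4 * t < 4 * a + 4 * L
    bounds {t} ((a≤t , t<a+L) , _) =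
      *-monoʳ-≤ 4 a≤t , subst (4 * t <_) (*-distribˡ-+ 4 a L) (*-monoʳ-< 4 t<a+L)

-- The Pell equation t² = r k² + 4

-- If t² = c² + 4 then c < t, so c ≤ t − 1 and t² ≤ (t − 1)² + 4, forcing t ≤ 2.
square≢square+4 : ∀ {t c} → 3 ≤ t → t * t ≢ c * c + 4
square≢square+4 {1} (s≤s ())
square≢square+4 {2} (s≤s (s≤s ()))
square≢square+4 {t@(suc s@(suc (suc u)))} {c} _ t²≡c²+4 = <-irrefl (sym t²≡c²+4) (begin-strict
  c * c + 4    ≤⟨ +-monoˡ-≤ 4 (*-mono-≤ c≤s c≤s) ⟩
  s * s + 4    <⟨ s≤s (m≤m+n (s * s + 4) (2 * u)) ⟩
  suc (s * s + 4 + 2 * u) ≡⟨ [3+u]²≡ u ⟨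
  t * t        ∎)
  where
  open ≤-Reasoning
  c≤s : c ≤ s
  c≤s = ≤-pred (square-cancel-< (subst (c * c <_) (sym t²≡c²+4) (m<m+n (c * c) (s≤s z≤n))))
  [3+u]²≡ : ∀ u → (3 + u) * (3 + u) ≡ suc ((2 + u) * (2 + u) + 4 + 2 * u)
  [3+u]²≡ = solve-∀

-- r Y² = 9 would make t² − 4 = r k² a perfect square: (3k)² for (r, Y) = (9, 1), k² for (1, 3).
rY²≢9 : ∀ {t r k Y} → 3 ≤ t → t * t ≡ r * (k * k) + 4 → r * (Y * Y) ≢ 9
rY²≢9 {r = r} {Y = 0} _ _ r*0≡9 with () ← trans (sym (*-zeroʳ r)) r*0≡9
rY²≢9 {t} {r} {k} {Y = 1} 3≤t t²≡ r*1≡9 =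
  square≢square+4 {c = 3 * k} 3≤t (trans t²≡ (cong (_+ 4) 9k²≡[3k]²))
  where
  9k²≡[3k]² : r * (k * k) ≡ 3 * k * (3 * k)
  9k²≡[3k]² = trans (cong (_* (k * k)) (trans (sym (*-identityʳ r)) r*1≡9)) (9k²≡ k)
    where
    9k²≡ : ∀ k → 9 * (k * k) ≡ 3 * k * (3 * k)
    9k²≡ = solve-∀
rY²≢9 {r = 0} {Y = 2} _ _ ()
rY²≢9 {r = 1} {Y = 2} _ _ ()
rY²≢9 {r = 2} {Y = 2} _ _ ()
rY²≢9 {r = suc (suc (suc _))} {Y = 2} _ _ ()
rY²≢9 {t} {r} {k} {Y = 3} 3≤t t²≡ r*9≡9 =
  square≢square+4 {c = k} 3≤t (trans t²≡ (cong (_+ 4) (trans (cong (_* (k * k)) r≡1) (*-identityˡ (k * k)))))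
  where
  r≡1 : r ≡ 1
  r≡1 = *-cancelʳ-≡ r 1 9 r*9≡9
rY²≢9 {r = 0} {Y = suc (suc (suc (suc _)))} _ _ ()
rY²≢9 {r = suc r} {Y = Y@(suc (suc (suc (suc _))))} _ _ rY²≡9 =
  <⇒≱ (m≤m+n 10 6) (begin
    16                       ≤⟨ *-mono-≤ {4} {Y} (m≤m+n 4 _) (m≤m+n 4 _) ⟩
    Y * Y                    ≤⟨ m≤m+n (Y * Y) (r * (Y * Y)) ⟩
    suc r * (Y * Y)          ≡⟨ rY²≡9 ⟩
    9                        ∎)
  where open ≤-Reasoning

-- X ≤ 4 contradicts r Y² > 0 and X = 5 gives r Y² = 9; so X ≥ 6, hence r Y² ≥ 20 and
-- (r Y k)² ≥ 20 r k² ≥ (2t)².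
8t≤Xt+rYk : ∀ {t r k X Y} → 3 ≤ t → t * t ≡ r * (k * k) + 4 → X * X ≡ r * (Y * Y) + 16 → 0 < Y →
  8 * t ≤ X * t + r * Y * k
8t≤Xt+rYk {t} {r} {k} {X} {Y} 3≤t t²≡ X²≡ 0<Y = by-size (6 ≤? X)
  where
  open ≤-Reasoning
  5≤rk² : 5 ≤ r * (k * k)
  5≤rk² = +-cancelʳ-≤ 4 5 _ (≤-trans (*-mono-≤ 3≤t 3≤t) (≤-reflexive t²≡))
  0<r : 0 < r
  0<r = ≰⇒> λ r≤0 →
    <⇒≱ (≤-trans (s≤s z≤n) 5≤rk²) (≤-reflexive (cong (_* (k * k)) (n≤0⇒n≡0 r≤0)))
  by-size : Dec (6 ≤ X) → 8 * t ≤ X * t + r * Y * k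
  by-size (yes 6≤X) = begin
    8 * t               ≡⟨ *-distribʳ-+ t 6 2 ⟩
    6 * t + 2 * t       ≤⟨ +-mono-≤ (*-monoˡ-≤ t 6≤X) 2t≤rYk ⟩
    X * t + r * Y * k   ∎
    where
    20≤rY² : 20 ≤ r * (Y * Y)
    20≤rY² = +-cancelʳ-≤ 16 20 _ (≤-trans (*-mono-≤ 6≤X 6≤X) (≤-reflexive X²≡))
    [2t]²≡ : ∀ t → 2 * t * (2 * t) ≡ 4 * (t * t)
    [2t]²≡ = solve-∀
    [rYk]²≡ : ∀ r Y k → r * Y * k * (r * Y * k) ≡ r * (Y * Y) * (r * (k * k))
    [rYk]²≡ = solve-∀
    2t≤rYk : 2 * t ≤ r * Y * k
    2t≤rYk = square-cancel-≤ (begin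
      2 * t * (2 * t)                         ≡⟨ [2t]²≡ t ⟩
      4 * (t * t)                             ≡⟨ cong (4 *_) t²≡ ⟩
      4 * (r * (k * k) + 4)                   ≡⟨ *-distribˡ-+ 4 (r * (k * k)) 4 ⟩
      4 * (r * (k * k)) + 16
        ≤⟨ +-monoʳ-≤ (4 * (r * (k * k))) (*-monoʳ-≤ 16 (≤-trans (s≤s z≤n) 5≤rk²)) ⟩
      4 * (r * (k * k)) + 16 * (r * (k * k))  ≡⟨ *-distribʳ-+ (r * (k * k)) 4 16 ⟨
      20 * (r * (k * k))                      ≤⟨ *-monoˡ-≤ (r * (k * k)) 20≤rY² ⟩
      r * (Y * Y) * (r * (k * k))             ≡⟨ [rYk]²≡ r Y k ⟨
      r * Y * k * (r * Y * k)                 ∎)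
  by-size (no 6≰X) with X ≟ 5
  ... | yes refl =
    contradiction (+-cancelʳ-≡ 16 (r * (Y * Y)) 9 (sym X²≡)) (rY²≢9 {t} {r} {k} {Y} 3≤t t²≡)
  ... | no  X≢5  = contradiction (begin
    r * (Y * Y) + 16  ≡⟨ X²≡ ⟨
    X * X             ≤⟨ *-mono-≤ X≤4 X≤4 ⟩
    16                ∎) (<⇒≱ (+-monoˡ-< 16 0<rY²))
    where
    X≤4 : X ≤ 4
    X≤4 = ≤-pred (≤∧≢⇒< (≤-pred (≰⇒> 6≰X)) X≢5)
    0<rY² : 0 < r * (Y * Y)
    0<rY² = *-mono-≤ 0<r (*-mono-≤ 0<Y 0<Y)

module _ where
  open import Data.Integer using (+_)

  -- Brahmagupta: X − Y√r = (t₁ + k₁√r)(t₂ − k₂√r), where X = t₁t₂ − rk₁k₂ and Y = t₁k₂ − t₂k₁, has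
  -- norm (t₁² − rk₁²)(t₂² − rk₂²); multiplied by t₁ − k₁√r it has rational part t₂ (t₁² − rk₁²).
  brahmagupta : ∀ r t₁ t₂ k₁ k₂ →
    (t₁ ℤ.* t₂ ℤ.- r ℤ.* k₁ ℤ.* k₂) ℤ.* (t₁ ℤ.* t₂ ℤ.- r ℤ.* k₁ ℤ.* k₂)
      ≡ r ℤ.* ((t₁ ℤ.* k₂ ℤ.- t₂ ℤ.* k₁) ℤ.* (t₁ ℤ.* k₂ ℤ.- t₂ ℤ.* k₁))
        ℤ.+ (t₁ ℤ.* t₁ ℤ.- r ℤ.* (k₁ ℤ.* k₁)) ℤ.* (t₂ ℤ.* t₂ ℤ.- r ℤ.* (k₂ ℤ.* k₂))
  brahmagupta = ℤ-Solver.solve-∀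

  brahmagupta-trace : ∀ r t₁ t₂ k₁ k₂ →
    (t₁ ℤ.* t₂ ℤ.- r ℤ.* k₁ ℤ.* k₂) ℤ.* t₁ ℤ.+ r ℤ.* (t₁ ℤ.* k₂ ℤ.- t₂ ℤ.* k₁) ℤ.* k₁
      ≡ t₂ ℤ.* (t₁ ℤ.* t₁ ℤ.- r ℤ.* (k₁ ℤ.* k₁))
  brahmagupta-trace = ℤ-Solver.solve-∀

  pos-∸ : ∀ {m n x} → m ≡ n + x → + x ≡ + m ℤ.- + n
  pos-∸ {n = n} {x} refl = trans (x≡[n+x]-n (+ n) (+ x)) (cong (ℤ._- + n) (sym (ℤₚ.pos-+ n x)))
    where
    x≡[n+x]-n : ∀ n x → x ≡ n ℤ.+ x ℤ.- n
    x≡[n+x]-n = ℤ-Solver.solve-∀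

  -- X and Y are given additively to avoid truncated subtraction.
  composition : ∀ {r t₁ t₂ k₁ k₂ X Y} →
    t₁ * t₁ ≡ r * (k₁ * k₁) + 4 → t₂ * t₂ ≡ r * (k₂ * k₂) + 4 →
    t₁ * t₂ ≡ r * k₁ * k₂ + X → t₁ * k₂ ≡ t₂ * k₁ + Y →
    X * X ≡ r * (Y * Y) + 16 × X * t₁ + r * Y * k₁ ≡ 4 * t₂
  composition {r} {t₁} {t₂} {k₁} {k₂} {X} {Y} h₁ h₂ hX hY =
    ℤₚ.+-injective norm , ℤₚ.+-injective trace
    where
    open ≡-Reasoning
    pos-*³ : ∀ a b c → + (a * b * c) ≡ + a ℤ.* + b ℤ.* + c
    pos-*³ a b c = trans (ℤₚ.pos-* (a * b) c) (cong (ℤ._* + c) (ℤₚ.pos-* a b))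
    X≡ : + X ≡ + t₁ ℤ.* + t₂ ℤ.- + r ℤ.* + k₁ ℤ.* + k₂
    X≡ = trans (pos-∸ hX) (cong₂ ℤ._-_ (ℤₚ.pos-* t₁ t₂) (pos-*³ r k₁ k₂))
    Y≡ : + Y ≡ + t₁ ℤ.* + k₂ ℤ.- + t₂ ℤ.* + k₁
    Y≡ = trans (pos-∸ hY) (cong₂ ℤ._-_ (ℤₚ.pos-* t₁ k₂) (ℤₚ.pos-* t₂ k₁))
    pos-rkk : ∀ k → + (r * (k * k)) ≡ + r ℤ.* (+ k ℤ.* + k)
    pos-rkk k = trans (ℤₚ.pos-* r (k * k)) (cong (+ r ℤ.*_) (ℤₚ.pos-* k k))
    4≡ : ∀ {t k} → t * t ≡ r * (k * k) + 4 → + 4 ≡ + t ℤ.* + t ℤ.- + r ℤ.* (+ k ℤ.* + k)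
    4≡ {t} {k} h = trans (pos-∸ h) (cong₂ ℤ._-_ (ℤₚ.pos-* t t) (pos-rkk k))
    norm : + (X * X) ≡ + (r * (Y * Y) + 16)
    norm = begin
      + (X * X)  ≡⟨ trans (ℤₚ.pos-* X X) (cong₂ ℤ._*_ X≡ X≡) ⟩
      _          ≡⟨ brahmagupta (+ r) (+ t₁) (+ t₂) (+ k₁) (+ k₂) ⟩
      _          ≡⟨ cong₂ (λ y n → + r ℤ.* (y ℤ.* y) ℤ.+ n) Y≡
                          (cong₂ ℤ._*_ (4≡ {t₁} {k₁} h₁) (4≡ {t₂} {k₂} h₂)) ⟨
      + r ℤ.* (+ Y ℤ.* + Y) ℤ.+ + 16
                 ≡⟨ trans (ℤₚ.pos-+ (r * (Y * Y)) 16) (cong (ℤ._+ + 16) (pos-rkk Y)) ⟨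
      + (r * (Y * Y) + 16) ∎
    trace : + (X * t₁ + r * Y * k₁) ≡ + (4 * t₂)
    trace = begin
      + (X * t₁ + r * Y * k₁)
        ≡⟨ trans (ℤₚ.pos-+ (X * t₁) _) (cong₂ ℤ._+_ (ℤₚ.pos-* X t₁) (pos-*³ r Y k₁)) ⟩
      + X ℤ.* + t₁ ℤ.+ + r ℤ.* + Y ℤ.* + k₁
        ≡⟨ cong₂ (λ x y → x ℤ.* + t₁ ℤ.+ + r ℤ.* y ℤ.* + k₁) X≡ Y≡ ⟩
      _ ≡⟨ brahmagupta-trace (+ r) (+ t₁) (+ t₂) (+ k₁) (+ k₂) ⟩
      + t₂ ℤ.* _
        ≡⟨ cong (+ t₂ ℤ.*_) (4≡ {t₁} {k₁} h₁) ⟨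
      + t₂ ℤ.* + 4
        ≡⟨ trans (ℤₚ.pos-* 4 t₂) (ℤₚ.*-comm (+ 4) (+ t₂)) ⟨
      + (4 * t₂) ∎

-- The composite X − Y√r = (t₁ + k₁√r)(t₂ − k₂√r) has Y > 0 as t₁ < t₂, so 8 t₁ ≤ X t₁ + r Y k₁ = 4 t₂.
pell-gap : ∀ {r t₁ t₂ k₁ k₂} → 3 ≤ t₁ → t₁ < t₂ →
  t₁ * t₁ ≡ r * (k₁ * k₁) + 4 → t₂ * t₂ ≡ r * (k₂ * k₂) + 4 → 2 * t₁ ≤ t₂
pell-gap {r} {t₁} {t₂} {k₁} {k₂} 3≤t₁ t₁<t₂ h₁ h₂ = *-cancelˡ-≤ 4 (begin
  4 * (2 * t₁)         ≡⟨ *-assoc 4 2 t₁ ⟨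
  8 * t₁               ≤⟨ 8t≤Xt+rYk {t₁} {r} {k₁} {X} {Y} 3≤t₁ h₁ (proj₁ composite) 0<Y ⟩
  X * t₁ + r * Y * k₁  ≡⟨ proj₂ composite ⟩
  4 * t₂               ∎)
  where
  open ≤-Reasoning
  X = t₁ * t₂ ∸ r * k₁ * k₂
  Y = t₁ * k₂ ∸ t₂ * k₁
  [tt′]²≡ : ∀ {t t′ k′} → t′ * t′ ≡ r * (k′ * k′) + 4 →
    t * t′ * (t * t′) ≡ r * (t * k′ * (t * k′)) + 4 * (t * t)
  [tt′]²≡ {t} {t′} {k′} h = trans (square-* t t′) (trans (cong (t * t *_) h) (distrib t r k′))
    where
    square-* : ∀ t t′ → t * t′ * (t * t′) ≡ t * t * (t′ * t′)
    square-* = solve-∀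
    distrib : ∀ t r k′ → t * t * (r * (k′ * k′) + 4) ≡ r * (t * k′ * (t * k′)) + 4 * (t * t)
    distrib = solve-∀
  t₂k₁<t₁k₂ : t₂ * k₁ < t₁ * k₂
  t₂k₁<t₁k₂ = square-cancel-< (*-cancelˡ-< r _ _
    (+-cancelʳ-< (4 * (t₂ * t₂)) (r * (t₂ * k₁ * (t₂ * k₁))) _ (begin-strict
    r * (t₂ * k₁ * (t₂ * k₁)) + 4 * (t₂ * t₂)  ≡⟨ [tt′]²≡ {t₂} {t₁} {k₁} h₁ ⟨
    t₂ * t₁ * (t₂ * t₁)                        ≡⟨ cong (λ n → n * n) (*-comm t₂ t₁) ⟩
    t₁ * t₂ * (t₁ * t₂)                        ≡⟨ [tt′]²≡ {t₁} {t₂} {k₂} h₂ ⟩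
    r * (t₁ * k₂ * (t₁ * k₂)) + 4 * (t₁ * t₁)
      <⟨ +-monoʳ-< (r * (t₁ * k₂ * (t₁ * k₂))) (*-monoʳ-< 4 (*-mono-< t₁<t₂ t₁<t₂)) ⟩
    r * (t₁ * k₂ * (t₁ * k₂)) + 4 * (t₂ * t₂)  ∎)))
  rk₁k₂<t₁t₂ : r * k₁ * k₂ < t₁ * t₂
  rk₁k₂<t₁t₂ = square-cancel-< (begin-strict
    r * k₁ * k₂ * (r * k₁ * k₂)                ≡⟨ [rk₁k₂]²≡ r k₁ k₂ ⟩
    r * (k₁ * k₁) * (r * (k₂ * k₂))
      <⟨ *-mono-< (m<m+n (r * (k₁ * k₁)) 0<4) (m<m+n (r * (k₂ * k₂)) 0<4) ⟩
    (r * (k₁ * k₁) + 4) * (r * (k₂ * k₂) + 4)  ≡⟨ cong₂ _*_ h₁ h₂ ⟨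
    t₁ * t₁ * (t₂ * t₂)                        ≡⟨ [t₁t₂]²≡ t₁ t₂ ⟩
    t₁ * t₂ * (t₁ * t₂)                        ∎)
    where
    0<4 : 0 < 4
    0<4 = s≤s z≤n
    [rk₁k₂]²≡ : ∀ r k₁ k₂ → r * k₁ * k₂ * (r * k₁ * k₂) ≡ r * (k₁ * k₁) * (r * (k₂ * k₂))
    [rk₁k₂]²≡ = solve-∀
    [t₁t₂]²≡ : ∀ t₁ t₂ → t₁ * t₁ * (t₂ * t₂) ≡ t₁ * t₂ * (t₁ * t₂)
    [t₁t₂]²≡ = solve-∀
  composite : X * X ≡ r * (Y * Y) + 16 × X * t₁ + r * Y * k₁ ≡ 4 * t₂
  composite = composition {r} {t₁} {t₂} {k₁} {k₂} {X} {Y} h₁ h₂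
    (sym (m+[n∸m]≡n (<⇒≤ rk₁k₂<t₁t₂))) (sym (m+[n∸m]≡n (<⇒≤ t₂k₁<t₁k₂)))
  0<Y : 0 < Y
  0<Y = m<n⇒0<n∸m t₂k₁<t₁k₂

-- 2√(Bn) + √(B/(n+1)) ≤ 2√(B(n+1)) in integers: writing B = k² + w, the cross term obeys
-- (2kS)² ≤ 16 B w ≤ (4w + 3k²)².
√-step : ∀ {S k n B} → S * S ≤ 4 * B * n → k * k * suc n ≤ B → (k + S) * (k + S) ≤ 4 * B * suc n
√-step {S} {k} {n} {B} S²≤ k²[1+n]≤B
  with w , refl ← m≤n⇒∃[o]m+o≡n (≤-trans (m≤m*n (k * k) (suc n)) k²[1+n]≤B) = begin
  (k + S) * (k + S)                            ≡⟨ solve (List ℕ ∋ (k ∷ S ∷ [])) ⟩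
  k * k + 2 * k * S + S * S                    ≤⟨ +-mono-≤ (+-monoʳ-≤ (k * k) 2kS≤) S²≤ ⟩
  k * k + (4 * w + 3 * (k * k)) + 4 * (k * k + w) * n ≡⟨ solve (List ℕ ∋ (k ∷ w ∷ n ∷ [])) ⟩
  4 * (k * k + w) * suc n                      ∎
  where
  open ≤-Reasoning
  nk²≤w : n * (k * k) ≤ w
  nk²≤w = +-cancelˡ-≤ (k * k) _ _ (begin
    k * k + n * (k * k)  ≡⟨ solve (List ℕ ∋ (k ∷ n ∷ [])) ⟩
    k * k * suc n        ≤⟨ k²[1+n]≤B ⟩
    k * k + w            ∎)
  2kS≤ : 2 * k * S ≤ 4 * w + 3 * (k * k)
  2kS≤ = square-cancel-≤ (begin
    2 * k * S * (2 * k * S)                    ≡⟨ solve (List ℕ ∋ (k ∷ S ∷ [])) ⟩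
    4 * (k * k) * (S * S)                      ≤⟨ *-monoʳ-≤ (4 * (k * k)) S²≤ ⟩
    4 * (k * k) * (4 * (k * k + w) * n)        ≡⟨ solve (List ℕ ∋ (k ∷ w ∷ n ∷ [])) ⟩
    16 * (k * k + w) * (n * (k * k))           ≤⟨ *-monoʳ-≤ (16 * (k * k + w)) nk²≤w ⟩
    16 * (k * k + w) * w                       ≤⟨ m≤m+n _ _ ⟩
    16 * (k * k + w) * w + (8 * w * (k * k) + 9 * (k * k) * (k * k)) ≡⟨ solve (List ℕ ∋ (k ∷ w ∷ [])) ⟩
    (4 * w + 3 * (k * k)) * (4 * w + 3 * (k * k)) ∎)

module _ (k r : A → ℕ) (B : ℕ) where

  private
    Distinct : List A → Set
    Distinct = AllPairs (λ s t → r s ≢ r t)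

    Cofactor≤ : ℕ → A → Set
    Cofactor≤ R t = 0 < r t × r t ≤ R × k t * k t * r t ≤ B

    -- Σ k ≤ Σ_{j ≤ n} √(B/j) ≤ 2√(Bn). Induction on the bound R for the cofactors: at most one t has
    -- r t = R, and the n ≤ R − 1 others give k t² (n + 1) ≤ k t² R ≤ B, as √-step needs.
    sum²-cofactors≤ : ∀ R ts → Distinct ts → All (Cofactor≤ R) ts →
      length ts ≤ R × sum (map k ts) * sum (map k ts) ≤ 4 * B * length ts
    sum²-cofactors≤ zero    []      _ _                         = z≤n , z≤n
    sum²-cofactors≤ zero    (t ∷ _) _ ((0<rt , rt≤0 , _) ∷ _) = contradiction rt≤0 (<⇒≱ 0<rt)
    sum²-cofactors≤ (suc R) ts distinct bounded =
      subst₂ (λ ℓ s → ℓ ≤ suc R × s * s ≤ 4 * B * ℓ)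
        (sym (length-filter-∁ top? ts)) (sym (sum-map-filter-∁ top? k ts))
        (with-top (filter top? ts) (AllPairs.filter⁺ top? distinct) (All.all-filter top? ts)
                  (All.filter⁺ top? bounded))
      where
      top? : ∀ t → Dec (r t ≡ suc R)
      top? t = r t ≟ suc R
      rest = filter (∁? top?) ts
      n = length rest
      S = sum (map k rest)
      ih : n ≤ R × S * S ≤ 4 * B * n
      ih = sum²-cofactors≤ R rest (AllPairs.filter⁺ (∁? top?) distinct)
        (All.zipWith (λ (rt≢ , (0<rt , rt≤1+R , kkr≤B)) → 0<rt , ≤-pred (≤∧≢⇒< rt≤1+R rt≢) , kkr≤B)
          (All.all-filter (∁? top?) ts , All.filter⁺ (∁? top?) bounded))
      with-top : ∀ tops → Distinct tops → All (λ t → r t ≡ suc R) tops → All (Cofactor≤ (suc R)) tops →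
        length tops + n ≤ suc R × (sum (map k tops) + S) * (sum (map k tops) + S) ≤ 4 * B * (length tops + n)
      with-top []          _                  _               _                    =
        m≤n⇒m≤1+n (proj₁ ih) , proj₂ ih
      with-top (t ∷ [])    _                  (rt≡1+R ∷ [])  ((_ , _ , kkr≤B) ∷ []) =
        s≤s (proj₁ ih) ,
        subst (λ x → (x + S) * (x + S) ≤ 4 * B * suc n) (sym (+-identityʳ (k t)))
          (√-step {S} {k t} {n} {B} (proj₂ ih) k²[1+n]≤B)
        where
        k²[1+n]≤B : k t * k t * suc n ≤ B
        k²[1+n]≤B =
          ≤-trans (*-monoʳ-≤ (k t * k t) (subst (suc n ≤_) (sym rt≡1+R) (s≤s (proj₁ ih)))) kkr≤B
      with-top (t ∷ u ∷ _) ((rt≢ru ∷ _) ∷ _) (rt≡ ∷ ru≡ ∷ _) _ =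
        contradiction (trans rt≡ (sym ru≡)) rt≢ru

  distinct-cofactors⇒sum²≤ : ∀ ts → Distinct ts →
    All (λ t → 0 < k t × 0 < r t × k t * k t * r t ≤ B) ts →
    sum (map k ts) * sum (map k ts) ≤ 4 * B * length ts
  distinct-cofactors⇒sum²≤ ts distinct bounded = proj₂ (sum²-cofactors≤ B ts distinct (All.map r≤B bounded))
    where
    r≤B : ∀ {t} → 0 < k t × 0 < r t × k t * k t * r t ≤ B → Cofactor≤ B t
    r≤B {t} (0<kt , 0<rt , kkr≤B) =
      0<rt , ≤-trans (m≤n*m (r t) (k t * k t) {{>-nonZero (*-mono-≤ 0<kt 0<kt)}}) kkr≤B , kkr≤B

tsq4-pos : ∀ {t} → 3 ≤ t → 0 < tsq4 t
tsq4-pos 3≤t = ≤-trans (s≤s z≤n) (∸-monoˡ-≤ 4 (*-mono-≤ 3≤t 3≤t))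

tsq4-pell : ∀ {t} → 3 ≤ t → t * t ≡ squarefreePart (tsq4 t) * (maxSq (tsq4 t) * maxSq (tsq4 t)) + 4
tsq4-pell {t} 3≤t =
  trans (sym (m∸n+n≡m (*-mono-≤ 2≤t 2≤t))) (cong (_+ 4) (squarefreePart-maxSq (tsq4 t)))
  where
  2≤t : 2 ≤ t
  2≤t = ≤-trans (s≤s (s≤s z≤n)) 3≤t

sumMaxSq : ℕ → ℕ → ℕ
sumMaxSq a L = sum (map (maxSq ∘ tsq4) (range a L))

-- For a ≤ t < 2a the squarefree parts of t² − 4 are distinct, as pell-gap forbids t₁ < t₂ < 2 t₁.
sumMaxSq²≤ : ∀ {a L} → 3 ≤ a → a + L ≤ 2 * a → sumMaxSq a L * sumMaxSq a L ≤ 16 * (a * a * L)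
sumMaxSq²≤ {a} {L} 3≤a a+L≤2a = begin
  sumMaxSq a L * sumMaxSq a L
    ≤⟨ distinct-cofactors⇒sum²≤ (maxSq ∘ tsq4) (squarefreePart ∘ tsq4) (2 * a * (2 * a)) (range a L)
                                distinct bounded ⟩
  4 * (2 * a * (2 * a)) * length (range a L) ≡⟨ cong (4 * (2 * a * (2 * a)) *_) (length-applyUpTo (a +_) L) ⟩
  4 * (2 * a * (2 * a)) * L                  ≡⟨ solve (List ℕ ∋ (a ∷ L ∷ [])) ⟩
  16 * (a * a * L)                           ∎
  where
  open ≤-Reasoning
  k r : ℕ → ℕ
  k t = maxSq (tsq4 t)
  r t = squarefreePart (tsq4 t)
  distinct : AllPairs (λ s t → r s ≢ r t) (range a L)
  distinct = AllPairs-range λ {s} {t} a≤s s<t t<a+L rs≡rt →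
    let 3≤s = ≤-trans 3≤a a≤s
        t²≡ = trans (tsq4-pell (≤-trans 3≤s (<⇒≤ s<t))) (cong (λ r → r * (k t * k t) + 4) (sym rs≡rt))
    in <⇒≱ (<-≤-trans t<a+L (≤-trans a+L≤2a (*-monoʳ-≤ 2 a≤s)))
           (pell-gap {r s} {k₁ = k s} {k t} 3≤s s<t (tsq4-pell 3≤s) t²≡)
  bounded : All (λ t → 0 < k t × 0 < r t × k t * k t * r t ≤ 2 * a * (2 * a)) (range a L)
  bounded = All-range λ {t} a≤t t<a+L →
    let 0<u = tsq4-pos (≤-trans 3≤a a≤t)
        t≤2a = <⇒≤ (<-≤-trans t<a+L a+L≤2a)
    in maxSq-pos 0<u , squarefreePart-pos 0<u , (begin
      k t * k t * r t    ≡⟨ *-comm (k t * k t) (r t) ⟩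
      r t * (k t * k t)  ≡⟨ squarefreePart-maxSq (tsq4 t) ⟨
      tsq4 t             ≤⟨ m∸n≤m (t * t) 4 ⟩
      t * t              ≤⟨ *-mono-≤ t≤2a t≤2a ⟩
      2 * a * (2 * a)    ∎)

-- Charge each t to its own d = S(u, t² − 4), which has d² ∣ u and so d ≤ maxSq u.
sum-S₂-tsq4≤ : ∀ {a L u N} → 2 ≤ a → 0 < u → u ≤ N →
  sum (map (λ t → S₂ u (tsq4 t)) (range a L)) ≤ maxτ N * (maxτ N * (4 * L + maxSq u))
sum-S₂-tsq4≤ {a} {L} {u} {N} 2≤a 0<u u≤N = begin
  sum (map (λ t → S₂ u (tsq4 t)) (range a L))
    ≤⟨ sum-map-≤-cover (λ d t → d * d ∣? tsq4 t) (λ t → S₂ u (tsq4 t)) id D (range a L) covered ⟩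
  sum (map (λ d → d * count d) D)           ≤⟨ sum-map-mono D per-d ⟩
  sum (map (λ _ → T * (4 * L + maxSq u)) D) ≡⟨ sum-map-const _ D ⟩
  length D * (T * (4 * L + maxSq u))
    ≤⟨ *-monoˡ-≤ _ (≤-trans (length-filter _ (divisors u)) (τ≤maxτ 0<u u≤N)) ⟩
  T * (T * (4 * L + maxSq u))               ∎
  where
  open ≤-Reasoning
  T = maxτ N
  D = filter (λ d → d * d ∣? u) (divisors u)
  count : ℕ → ℕ
  count d = length (filter (λ t → d * d ∣? tsq4 t) (range a L))
  covered : ∀ {t} → t ∈ range a L → ∃[ d ] d ∈ D × d * d ∣ tsq4 t × S₂ u (tsq4 t) ≤ d
  covered {t} _ = d , ∈-filter⁺ (λ d → d * d ∣? u) (∈-divisors⁺ 0<u (∣-trans (m∣m*n d) dd∣u)) dd∣u ,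
                  ∣-trans dd∣g (gcd[m,n]∣n u (tsq4 t)) , ≤-refl
    where
    g = gcd u (tsq4 t)
    d = maxSq g
    dd∣g : d * d ∣ g
    dd∣g = maxSq-sq∣ g
    dd∣u : d * d ∣ u
    dd∣u = ∣-trans dd∣g (gcd[m,n]∣m u (tsq4 t))
  per-d : ∀ {d} → d ∈ D → d * count d ≤ T * (4 * L + maxSq u)
  per-d {d} d∈D = ≤-trans (*-cancelˡ-≤ d {{>-nonZero 0<d}} (begin
    d * (d * count d)                ≡⟨ trans (sym (*-assoc d d (count d))) (*-comm (d * d) (count d)) ⟩
    count d * (d * d)                ≤⟨ count-sq∣tsq4 L 2≤a 0<d ⟩
    τ (d * d) * (4 * L + d * d)      ≤⟨ *-mono-≤ τ≤T (+-monoˡ-≤ (d * d) (m≤m*n (4 * L) d {{>-nonZero 0<d}})) ⟩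
    T * (4 * L * d + d * d)          ≡⟨ factor-d T ⟩
    d * (T * (4 * L + d))            ∎))
    (*-monoʳ-≤ T (+-monoʳ-≤ (4 * L) (maxSq-maximal 0<u 0<d dd∣u)))
    where
    dd∣u : d * d ∣ u
    dd∣u = proj₂ (∈-filter⁻ (λ d → d * d ∣? u) {xs = divisors u} d∈D)
    0<d : 0 < d
    0<d = ∣⇒pos 0<u (∣-trans (m∣m*n d) dd∣u)
    τ≤T : τ (d * d) ≤ T
    τ≤T = τ≤maxτ (*-mono-≤ 0<d 0<d) (≤-trans (∣⇒≤ {{>-nonZero 0<u}} dd∣u) u≤N)
    factor-d : ∀ T → T * (4 * L * d + d * d) ≡ d * (T * (4 * L + d))
    factor-d T = solve (List ℕ ∋ (T ∷ L ∷ d ∷ []))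

sumS₂ : ℕ → ℕ → ℕ
sumS₂ a L = sum (map (λ t₁ → sum (map (λ t₂ → S₂ (tsq4 t₁) (tsq4 t₂)) (range a L))) (range a L))

sumS₂≤ : ∀ {a L} → 3 ≤ a → a + L ≤ 2 * a →
  sumS₂ a L ≤ maxτ (2 * a * (2 * a)) * (maxτ (2 * a * (2 * a)) * (L * (4 * L) + sumMaxSq a L))
sumS₂≤ {a} {L} 3≤a a+L≤2a = begin
  sum (map (λ t₁ → sum (map (λ t₂ → S₂ (tsq4 t₁) (tsq4 t₂)) I)) I)
    ≤⟨ sum-map-mono I (λ t∈ → let a≤t , t<a+L = ∈-range⁻ t∈ in
         sum-S₂-tsq4≤ {L = L} (≤-trans (s≤s (s≤s z≤n)) 3≤a) (tsq4-pos (≤-trans 3≤a a≤t))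
                      (tsq4≤ (<-≤-trans t<a+L a+L≤2a))) ⟩
  sum (map (λ t → T * (T * (4 * L + maxSq (tsq4 t)))) I)
    ≡⟨ trans (sum-map-*ˡ T _ I) (cong (T *_) (sum-map-*ˡ T _ I)) ⟩
  T * (T * sum (map (λ t → 4 * L + maxSq (tsq4 t)) I))
    ≡⟨ cong (λ s → T * (T * s)) (trans (sum-map-+ I) (cong (_+ sumMaxSq a L) (sum-map-const (4 * L) I))) ⟩
  T * (T * (length I * (4 * L) + sumMaxSq a L))
    ≡⟨ cong (λ n → T * (T * (n * (4 * L) + sumMaxSq a L))) (length-applyUpTo (a +_) L) ⟩
  T * (T * (L * (4 * L) + sumMaxSq a L)) ∎
  where
  open ≤-Reasoning
  I = range a L
  T = maxτ (2 * a * (2 * a))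
  tsq4≤ : ∀ {t} → t < 2 * a → tsq4 t ≤ 2 * a * (2 * a)
  tsq4≤ {t} t<2a = ≤-trans (m∸n≤m (t * t) 4) (*-mono-≤ (<⇒≤ t<2a) (<⇒≤ t<2a))

sumS₂²≤ : ∀ {a L} → 3 ≤ a → a + L ≤ 2 * a →
  sumS₂ a L * sumS₂ a L ≤ maxτ (2 * a * (2 * a)) ^ 4 * (32 * (a * a * L + a * L ^ 3))
sumS₂²≤ {a} {L} 3≤a a+L≤2a = begin
  sumS₂ a L * sumS₂ a L                              ≤⟨ *-mono-≤ (sumS₂≤ 3≤a a+L≤2a) (sumS₂≤ 3≤a a+L≤2a) ⟩
  T * (T * Z) * (T * (T * Z))                        ≡⟨ square-T²Z T Z ⟩
  T ^ 4 * (Z * Z)                                    ≤⟨ *-monoʳ-≤ (T ^ 4) ([x+y]²≤2[x²+y²] (L * (4 * L)) s₁) ⟩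
  T ^ 4 * (2 * ((L * (4 * L)) * (L * (4 * L)) + s₁ * s₁))
    ≤⟨ *-monoʳ-≤ (T ^ 4) (*-monoʳ-≤ 2 (+-mono-≤ L⁴-bound (sumMaxSq²≤ 3≤a a+L≤2a))) ⟩
  T ^ 4 * (2 * (16 * a * L ^ 3 + 16 * (a * a * L)))  ≡⟨ cong (T ^ 4 *_) (collect a L (L ^ 3)) ⟩
  T ^ 4 * (32 * (a * a * L + a * L ^ 3))             ∎
  where
  open ≤-Reasoning
  T = maxτ (2 * a * (2 * a))
  s₁ = sumMaxSq a L
  Z = L * (4 * L) + s₁
  square-T²Z : ∀ T Z → T * (T * Z) * (T * (T * Z)) ≡ T * (T * (T * (T * 1))) * (Z * Z)
  square-T²Z T Z = solve (List ℕ ∋ (T ∷ Z ∷ []))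
  collect : ∀ a L L³ → 2 * (16 * a * L³ + 16 * (a * a * L)) ≡ 32 * (a * a * L + a * L³)
  collect a L L³ = solve (List ℕ ∋ (a ∷ L ∷ L³ ∷ []))
  L≤a : L ≤ a
  L≤a = +-cancelˡ-≤ a L a (subst (a + L ≤_) (cong (a +_) (+-identityʳ a)) a+L≤2a)
  L⁴-bound : L * (4 * L) * (L * (4 * L)) ≤ 16 * a * L ^ 3
  L⁴-bound = begin
    L * (4 * L) * (L * (4 * L)) ≡⟨ [L*4L]² L ⟩
    16 * L * L ^ 3              ≤⟨ *-monoˡ-≤ (L ^ 3) (*-monoʳ-≤ 16 L≤a) ⟩
    16 * a * L ^ 3              ∎
    where
    [L*4L]² : ∀ L → L * (4 * L) * (L * (4 * L)) ≡ 16 * L * (L * (L * (L * 1)))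
    [L*4L]² L = solve (List ℕ ∋ (L ∷ []))

sumMaxSq^[2q]≤ : ∀ {a L} q → 3 ≤ a → a + L ≤ 2 * a →
  sumMaxSq a L ^ (2 * q) ≤ 16 ^ q * (a * a) * (a * a * L) ^ q
sumMaxSq^[2q]≤ {a} {L} q 3≤a a+L≤2a = begin
  sumMaxSq a L ^ (2 * q)          ≤⟨ x²≤y⇒x^[2q]≤y^q q (sumMaxSq²≤ 3≤a a+L≤2a) ⟩
  (16 * (a * a * L)) ^ q          ≡⟨ ^-distribʳ-* 16 (a * a * L) q ⟩
  16 ^ q * (a * a * L) ^ q        ≤⟨ *-monoˡ-≤ _ (m≤m*n (16 ^ q) (a * a) {{>-nonZero (*-mono-≤ 0<a 0<a)}}) ⟩
  16 ^ q * (a * a) * (a * a * L) ^ q ∎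
  where
  open ≤-Reasoning
  0<a : 0 < a
  0<a = ≤-trans (s≤s z≤n) 3≤a

sumS₂^[2q]≤ : ∀ {a L} q → .{{_ : NonZero q}} → 3 ≤ a → a + L ≤ 2 * a →
  sumS₂ a L ^ (2 * q) ≤ divisorBoundConstant (4 * q) * 4 * 32 ^ q * (a * a) * (a * a * L + a * L ^ 3) ^ q
sumS₂^[2q]≤ {a} {L} q 3≤a a+L≤2a = begin
  sumS₂ a L ^ (2 * q)                   ≤⟨ x²≤y⇒x^[2q]≤y^q q (sumS₂²≤ 3≤a a+L≤2a) ⟩
  (T ^ 4 * (32 * X)) ^ q                ≡⟨ ^-distribʳ-* (T ^ 4) (32 * X) q ⟩
  (T ^ 4) ^ q * (32 * X) ^ q            ≡⟨ cong₂ _*_ (^-*-assoc T 4 q) (^-distribʳ-* 32 X q) ⟩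
  T ^ (4 * q) * (32 ^ q * X ^ q)        ≤⟨ *-monoˡ-≤ _ (maxτ^K≤ (*-mono-< 0<2a 0<2a)) ⟩
  C * (2 * a * (2 * a)) * (32 ^ q * X ^ q) ≡⟨ rearrange C a (32 ^ q) (X ^ q) ⟩
  C * 4 * 32 ^ q * (a * a) * X ^ q      ∎
  where
  open ≤-Reasoning
  instance
    4q≢0 : NonZero (4 * q)
    4q≢0 = m*n≢0 4 q
  open DivisorBound (4 * q)
  T = maxτ (2 * a * (2 * a))
  X = a * a * L + a * L ^ 3
  C = divisorBoundConstant (4 * q)
  0<2a : 0 < 2 * a
  0<2a = *-monoʳ-< 2 (≤-trans (s≤s z≤n) 3≤a)
  rearrange : ∀ C a y z → C * (2 * a * (2 * a)) * (y * z) ≡ C * 4 * y * (a * a) * z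
  rearrange C a y z = solve (List ℕ ∋ (C ∷ a ∷ y ∷ z ∷ []))

absorb-a² : ∀ {s c C a p Y} → c ≤ C → 0 < a → 0 < p → s ≤ c * (a * a) * Y → s ≤ C * a ^ (2 * p) * Y
absorb-a² {s} {c} {C} {a} {p} {Y} c≤C 0<a 0<p s≤ = ≤-trans s≤ (*-monoˡ-≤ Y (*-mono-≤ c≤C a²≤a^[2p]))
  where
  a²≤a^[2p] : a * a ≤ a ^ (2 * p)
  a²≤a^[2p] = subst (_≤ a ^ (2 * p)) (cong (a *_) (*-identityʳ a))
    (^-monoʳ-≤ a {{>-nonZero 0<a}} (*-monoʳ-≤ 2 0<p))

lemma3p6 : (p q : ℕ) → 1 ≤ p → 1 ≤ q →
    Σ ℕ λ C →
      ((a b : ℕ) → 3 ≤ a → a < b → b ≤ 2 * a →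
        (sumRange a b (λ t → maxSq (tsq4 t))) ^ (2 * q)
          ≤ C * a ^ (2 * p) * (a * a * (b ∸ a)) ^ q)
      ×
      ((a b : ℕ) → 3 ≤ a → a < b → b ≤ 2 * a →
        (sumRange a b (λ t₁ → sumRange a b (λ t₂ → S₂ (tsq4 t₁) (tsq4 t₂)))) ^ (2 * q)
          ≤ C * a ^ (2 * p) * (a * a * (b ∸ a) + a * (b ∸ a) ^ 3) ^ q)
lemma3p6 p q 0<p 0<q = C₁ + C₂ ,
  (λ a b 3≤a a<b b≤2a →
    absorb-a² (m≤m+n C₁ C₂) (0<a 3≤a) 0<p (sumMaxSq^[2q]≤ q 3≤a (a+L≤2a a<b b≤2a))) ,
  (λ a b 3≤a a<b b≤2a →
    absorb-a² (m≤n+m C₂ C₁) (0<a 3≤a) 0<p (sumS₂^[2q]≤ q 3≤a (a+L≤2a a<b b≤2a)))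
  where
  instance
    q≢0 : NonZero q
    q≢0 = >-nonZero 0<q
  C₁ = 16 ^ q
  C₂ = divisorBoundConstant (4 * q) * 4 * 32 ^ q
  0<a : ∀ {a} → 3 ≤ a → 0 < a
  0<a = ≤-trans (s≤s z≤n)
  a+L≤2a : ∀ {a b} → a < b → b ≤ 2 * a → a + (b ∸ a) ≤ 2 * a
  a+L≤2a a<b b≤2a = subst (_≤ _) (sym (m+[n∸m]≡n (<⇒≤ a<b))) b≤2a
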